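{- If $G\parallel\mathcal M\xrightarrow{\beta}G'\parallel\mathcal M'$, then for every path $\xi\in\mathrm{Paths}(G')$ there are $\xi_1,\xi_2$ with $\xi=\xi_1\cdot\xi_2$ and $\xi_1\cdot\beta\cdot\xi_2\in\mathrm{Paths}(G)$.
   Context: Participants $\mathsf p,\mathsf q,\mathsf r,\mathsf s$; labels $\lambda$. A message is $\langle\mathsf p,\lambda,\mathsf q\rangle$; a queue $\mathcal M$ is a finite sequence of messages ($\emptyset$, $\cdot$), modulo the congruence $\equiv$ generated by $\langle\mathsf p,\lambda,\mathsf q\rangle\cdot\langle\mathsf r,\lambda',\mathsf s\rangle\equiv\langle\mathsf r,\lambda',\mathsf s\rangle\cdot\langle\mathsf p,\lambda,\mathsf q\rangle$ when $\mathsf p\neq\mathsf r$ or $\mathsf q\neq\mathsf s$. Communications $\beta::=\mathsf p\mathsf q!\lambda\mid\mathsf p\mathsf q?\lambda$, $\mathrm{play}(\mathsf p\mathsf q!\lambda)=\mathsf p$, $\mathrm{play}(\mathsf p\mathsf q?\lambda)=\mathsf q$. Global types: possibly infinite regular terms $G ::= \mathsf{End}\mid \mathsf p\mathsf q!\{\lambda_i;G_i\}_{i\in I}\mid\mathsf p\mathsf q?\{\lambda_i;G_i\}_{i\in I}$ ($I$ finite nonempty, $\mathsf p\neq\mathsf q$, $\lambda_i$ distinct); $\mathsf p\mathsf q\dagger$ with $\dagger\in\{!,?\}$ denotes either form. A path is a possibly infinite sequence of communications ($\epsilon$ empty, $\cdot$ concatenation of a finite with a possibly infinite sequence). $\mathrm{Paths}(G)$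 is the greatest family of sets with $\mathrm{Paths}(\mathsf{End})=\{\epsilon\}$ and $\mathrm{Paths}(\mathsf p\mathsf q\dagger\{\lambda_i;G_i\}_{i\in I})=\bigcup_{i\in I}\{\mathsf p\mathsf q\dagger\lambda_i\cdot\xi\mid\xi\in\mathrm{Paths}(G_i)\}$. Type configuration transitions (inductive): (Top-Out) $\mathsf p\mathsf q!\{\lambda_i;G_i\}_{i\in I}\parallel\mathcal M\xrightarrow{\mathsf p\mathsf q!\lambda_h}G_h\parallel\mathcal M\cdot\langle\mathsf p,\lambda_h,\mathsf q\rangle$; (Top-In) $\mathsf p\mathsf q?\{\lambda_i;G_i\}_{i\in I}\parallel\langle\mathsf p,\lambda_h,\mathsf q\rangle\cdot\mathcal M\xrightarrow{\mathsf p\mathsf q?\lambda_h}G_h\parallel\mathcal M$ ($h\in I$); (Inside-Out) if $\mathsf p\neq\mathrm{play}(\beta)$ and $G_i\parallel\mathcal M\cdot\langle\mathsf p,\lambda_i,\mathsf q\rangle\xrightarrow{\beta}G'_i\parallel\mathcal M'\cdot\langle\mathsf p,\lambda_i,\mathsf q\rangle$ $\forall i\in I$, then $\mathsf p\mathsf q!\{\lambda_i;G_i\}\parallel\mathcal M\xrightarrow{\beta}\mathsf p\mathsf q!\{\lambda_i;G'_i\}\parallel\mathcal M'$; (Inside-In) if $\mathsf q\neq\mathrm{play}(\beta)$, $h\in I$, and $G_i\parallel\mathcal M\xrightarrow{\beta}G'_i\parallel\mathcal M'$ $\forall i\in I$, then $\mathsf p\mathsf q?\{\lambda_i;G_i\}\parallel\langle\mathsf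 p,\lambda_h,\mathsf q\rangle\cdot\mathcal M\xrightarrow{\beta}\mathsf p\mathsf q?\{\lambda_i;G'_i\}\parallel\langle\mathsf p,\lambda_h,\mathsf q\rangle\cdot\mathcal M'$. -}

module Defs where

open import Level using (Level; _⊔_) renaming (suc to lsuc; zero to lzero)
open import Data.Nat using (ℕ; zero; suc)
open import Data.Fin using (Fin)
open import Data.Maybe using (Maybe; just; nothing)
open import Data.List using (List; []; _∷_; _++_; [_])
open import Data.Sum using (_⊎_)
open import Data.Product using (Σ; ∃; _×_; _,_)
open import Relation.Binary.PropositionalEquality using (_≡_; _≢_; refl)
open import Function.Definitions using (Injective)

-- Directions: ! (output, snd) and ? (input, rcv)
data Dir : Set where
  snd rcv : Dir

-- Communications β ::= pq!λ | pq?λ   (comm d p q λ  is  pq d λ)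
data Comm (Part Label : Set) : Set where
  comm : Dir → Part → Part → Label → Comm Part Label

play : ∀ {Part Label : Set} → Comm Part Label → Part
play (comm snd p q _) = p
play (comm rcv p q _) = q

-- Possibly infinite sequences (paths).  (--guardedness is not
-- available, so a possibly infinite sequence over A is a function
-- ℕ → Maybe A which, once undefined, stays undefined; identity of
-- sequences is pointwise equality  _≐_ .)

record Seq (A : Set) : Set where
  field
    at   : ℕ → Maybe A
    stop : ∀ k → at k ≡ nothing → at (suc k) ≡ nothing
open Seq public

ε : ∀ {A : Set} → Seq A
at ε _ = nothing
stop ε _ _ = refl

cons : ∀ {A : Set} → A → Seq A → Seq A
at (cons x ξ) zero = just x
at (cons x ξ) (suc k) = at ξ k
stop (cons x ξ) zero ()
stop (cons x ξ) (suc k) e = stop ξ k e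

tail : ∀ {A : Set} → Seq A → Seq A
at (tail ξ) k = at ξ (suc k)
stop (tail ξ) k e = stop ξ (suc k) e

_·_ : ∀ {A : Set} → List A → Seq A → Seq A
[] · ξ = ξ
(x ∷ xs) · ξ = cons x (xs · ξ)
infixr 5 _·_

_≐_ : ∀ {A : Set} → Seq A → Seq A → Set
ξ ≐ ζ = ∀ k → at ξ k ≡ at ζ k

-- Global types are possibly infinite REGULAR terms
--   G ::= End | pq!{λi;Gi}_{i∈I} | pq?{λi;Gi}_{i∈I}
-- with I finite nonempty (I = Fin (suc n)), p ≠ q, λi distinct.
-- A regular term (finitely many distinct subterms) is presented by a
-- finite system of equations: finitely many nodes, each being End or a
-- branching whose continuations are nodes; the term is the unfolding
-- from a root node.  Terms are identified up to bisimilarity (equality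
-- of their infinite unfoldings), see  _≈ᵀ_  below.

data GTF (Part Label : Set) (X : Set) : Set where
  End : GTF Part Label X
  br  : (d : Dir) (p q : Part) → p ≢ q →
        (n : ℕ) (lab : Fin (suc n) → Label) → Injective _≡_ _≡_ lab →
        (cont : Fin (suc n) → X) → GTF Part Label X

mapGTF : ∀ {Part Label X Y : Set} → (X → Y) → GTF Part Label X → GTF Part Label Y
mapGTF f End = End
mapGTF f (br d p q pq n lab inj cont) = br d p q pq n lab inj (λ i → f (cont i))

record GT (Part Label : Set) : Set where
  field
    size  : ℕ
    graph : Fin size → GTF Part Label (Fin size)
    root  : Fin size
open GT public

view : ∀ {Part Label : Set} → GT Part Label → GTF Part Label (GT Part Label)
view G = mapGTF (λ x → record G { root = x }) (graph G (root G))

-- relating one unfolding step of two terms; branches {λi;Gi}_{i∈I} are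
-- compared as sets of labelled branches
data GRel {Part Label X Y : Set} (R : X → Y → Set) :
       GTF Part Label X → GTF Part Label Y → Set where
  end : GRel R End End
  br  : ∀ {d p q pq pq' n n' lab lab' c c'} {inj : Injective _≡_ _≡_ lab} {inj' : Injective _≡_ _≡_ lab'} →
        (∀ i → Σ (Fin (suc n')) λ j → lab i ≡ lab' j × R (c i) (c' j)) →
        (∀ j → Σ (Fin (suc n)) λ i → lab i ≡ lab' j × R (c i) (c' j)) →
        GRel R (br d p q pq n lab inj c) (br d p q pq' n' lab' inj' c')

_≈ᵀ_ : ∀ {Part Label : Set} → GT Part Label → GT Part Label → Set₁
G ≈ᵀ H = Σ (Fin (size G) → Fin (size H) → Set) λ R →
           R (root G) (root H) ×
           (∀ x y → R x y → GRel R (graph G x) (graph H y))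

-- Paths(G): the greatest family of sets with
--   Paths(End) = {ε},
--   Paths(pq†{λi;Gi}) = ⋃i { pq†λi · ξ | ξ ∈ Paths(Gi) }.
-- Greatest family = union of all post-fixed families (Knaster–Tarski).

data Unfold {Part Label : Set} (P : GT Part Label → Seq (Comm Part Label) → Set)
       (G : GT Part Label) (ξ : Seq (Comm Part Label)) : Set where
  u-end : view G ≡ End → ξ ≐ ε → Unfold P G ξ
  u-br  : ∀ {d p q pq n lab cont} {inj : Injective _≡_ _≡_ lab} →
          view G ≡ br d p q pq n lab inj cont →
          (i : Fin (suc n)) → (ζ : Seq (Comm Part Label)) →
          ξ ≐ cons (comm d p q (lab i)) ζ → P (cont i) ζ →
          Unfold P G ξ

PostFixed : ∀ {Part Label : Set} →
            (GT Part Label → Seq (Comm Part Label) → Set) → Set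
PostFixed P = ∀ G ξ → P G ξ → Unfold P G ξ

_∈Paths_ : ∀ {Part Label : Set} → Seq (Comm Part Label) → GT Part Label → Set₁
ξ ∈Paths G = Σ (GT _ _ → Seq (Comm _ _) → Set) λ P → PostFixed P × P G ξ

record Msg (Part Label : Set) : Set where
  constructor ⟨_,_,_⟩
  field
    sender   : Part
    label    : Label
    receiver : Part

Queue : Set → Set → Set
Queue Part Label = List (Msg Part Label)

data _≡ᴹ_ {Part Label : Set} : Queue Part Label → Queue Part Label → Set where
  ≡ᴹ-refl  : ∀ {M} → M ≡ᴹ M
  ≡ᴹ-sym   : ∀ {M N} → M ≡ᴹ N → N ≡ᴹ M
  ≡ᴹ-trans : ∀ {M N K} → M ≡ᴹ N → N ≡ᴹ K → M ≡ᴹ K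
  ≡ᴹ-swap  : ∀ (M₁ M₂ : Queue Part Label) {p q r s : Part} {l l' : Label} →
             (p ≢ r ⊎ q ≢ s) →
             (M₁ ++ ⟨ p , l , q ⟩ ∷ ⟨ r , l' , s ⟩ ∷ M₂)
               ≡ᴹ (M₁ ++ ⟨ r , l' , s ⟩ ∷ ⟨ p , l , q ⟩ ∷ M₂)

-- Configurations are taken modulo ≡ᴹ on queues and bisimilarity on
-- global types: the rule `conv` closes the relation on representatives
-- under these equalities.

data Step {Part Label : Set} :
       GT Part Label → Queue Part Label → Comm Part Label →
       GT Part Label → Queue Part Label → Set₁ where
  top-out : ∀ {G p q pq n lab cont M} {inj : Injective _≡_ _≡_ lab} (h : Fin (suc n)) →
            view G ≡ br snd p q pq n lab inj cont →
            Step G M (comm snd p q (lab h)) (cont h) (M ++ [ ⟨ p , lab h , q ⟩ ])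
  top-in  : ∀ {G p q pq n lab cont M} {inj : Injective _≡_ _≡_ lab} (h : Fin (suc n)) →
            view G ≡ br rcv p q pq n lab inj cont →
            Step G (⟨ p , lab h , q ⟩ ∷ M) (comm rcv p q (lab h)) (cont h) M
  inside-out : ∀ {G G' p q pq n lab cont cont' M M' β} {inj : Injective _≡_ _≡_ lab} →
            view G  ≡ br snd p q pq n lab inj cont →
            view G' ≡ br snd p q pq n lab inj cont' →
            p ≢ play β →
            (∀ i → Step (cont i) (M ++ [ ⟨ p , lab i , q ⟩ ]) β
                        (cont' i) (M' ++ [ ⟨ p , lab i , q ⟩ ])) →
            Step G M β G' M'
  inside-in : ∀ {G G' p q pq n lab cont cont' M M' β} {inj : Injective _≡_ _≡_ lab} (h : Fin (suc n)) →
            view G  ≡ br rcv p q pq n lab inj cont →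
            view G' ≡ br rcv p q pq n lab inj cont' →
            q ≢ play β →
            (∀ i → Step (cont i) M β (cont' i) M') →
            Step G (⟨ p , lab h , q ⟩ ∷ M) β G' (⟨ p , lab h , q ⟩ ∷ M')
  conv    : ∀ {G G' H H' M M' N N' β} →
            Step G M β G' M' →
            G ≈ᵀ H → G' ≈ᵀ H' → M ≡ᴹ N → M' ≡ᴹ N' →
            Step H N β H' N'

{-# OPTIONS --safe #-}
-- A top rule fires the first
-- communication of G, so every path of G' is a path of G with β put in
-- front.  An inside rule leaves the top communication of G in place: a
-- path of G' starts with it and continues in some branch, where the
-- induction hypothesis inserts β.  Since Paths is a greatest fixed point,
-- membership is shown by exhibiting post-fixed families, and it is
-- invariant under bisimilarity, which covers the closure rule.
module Submission where

open import Defs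
open import Data.List using (List; []; _∷_)
open import Data.Product using (Σ; _×_; _,_)
open import Data.Sum using (_⊎_; inj₁; inj₂)
open import Data.Nat using (zero; suc)
open import Data.Fin using (Fin)
open import Relation.Binary.PropositionalEquality using (_≡_; refl; sym; trans)
open import Function.Definitions using (Injective)

≐-cons-· : ∀ {A : Set} {x : A} (ξ ζ : Seq A) (ξ₁ : List A) (ξ₂ : Seq A) →
           ξ ≐ cons x ζ → ζ ≐ (ξ₁ · ξ₂) → ξ ≐ ((x ∷ ξ₁) · ξ₂)
≐-cons-· ξ ζ ξ₁ ξ₂ ξ≐ ζ≐ zero    = ξ≐ zero
≐-cons-· ξ ζ ξ₁ ξ₂ ξ≐ ζ≐ (suc k) = trans (ξ≐ (suc k)) (ζ≐ k)

module _ {Part Label : Set} where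

  private
    T = GT Part Label
    S = Seq (Comm Part Label)

  ≈ᵀ-sym : {G H : T} → G ≈ᵀ H → H ≈ᵀ G
  ≈ᵀ-sym (R , r₀ , rel) = (λ y x → R x y) , r₀ , λ y x r → GRel-flip (rel x y r)
    where
    GRel-flip : ∀ {gx gy} → GRel R gx gy → GRel (λ y x → R x y) gy gx
    GRel-flip end      = end
    GRel-flip (br f b) = br (λ j → let i , e , r = b j in i , sym e , r)
                            (λ i → let j , e , r = f i in j , sym e , r)

  Unfold-map : {P Q : T → S → Set} → (∀ {G ξ} → P G ξ → Q G ξ) →
               ∀ {G ξ} → Unfold P G ξ → Unfold Q G ξ
  Unfold-map f (u-end e s)      = u-end e s
  Unfold-map f (u-br e i ζ s p) = u-br e i ζ s (f p)

  Unfold-resp-GRel : ∀ {X Y : Set} {f : X → T} {g : Y → T} {R : X → Y → Set}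
                       {P Q : T → S → Set} {gx gy K L ξ} →
                     (∀ {x y ζ} → R x y → P (f x) ζ → Q (g y) ζ) →
                     GRel R gx gy → view K ≡ mapGTF f gx → view L ≡ mapGTF g gy →
                     Unfold P K ξ → Unfold Q L ξ
  Unfold-resp-GRel h end eK eL (u-end e s) = u-end eL s
  Unfold-resp-GRel h end eK eL (u-br e i ζ s p) with trans (sym eK) e
  ... | ()
  Unfold-resp-GRel h (br _ _) eK eL (u-end e s) with trans (sym eK) e
  ... | ()
  Unfold-resp-GRel h (br f _) eK eL (u-br e i ζ s p) with trans (sym eK) e
  ... | refl with f i
  ...   | j , lab≡ , r rewrite lab≡ = u-br eL j ζ s (h r p)

  ∈Paths-resp-≈ᵀ : {G H : T} {ξ : S} → G ≈ᵀ H → ξ ∈Paths G → ξ ∈Paths H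
  ∈Paths-resp-≈ᵀ {G} {H} (R , r₀ , rel) (P , post , pξ) =
    P′ , post′ , (root G , root H , r₀ , refl , pξ)
    where
    at-G : Fin (size G) → T
    at-G x = record G { root = x }
    at-H : Fin (size H) → T
    at-H y = record H { root = y }
    P′ : T → S → Set
    P′ K υ = Σ (Fin (size G)) λ x → Σ (Fin (size H)) λ y →
               R x y × K ≡ at-H y × P (at-G x) υ
    post′ : PostFixed P′
    post′ K υ (x , y , r , refl , p) =
      Unfold-resp-GRel (λ r′ p′ → _ , _ , r′ , refl , p′) (rel x y r) refl refl (post _ _ p)

  module _ {G : T} {d p q pq n lab cont} {inj : Injective _≡_ _≡_ lab}
           (view-G : view G ≡ br d p q pq n lab inj cont) where

    ∈Paths-br : (i : Fin (suc n)) {ζ : S} → ζ ∈Paths cont i →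
                cons (comm d p q (lab i)) ζ ∈Paths G
    ∈Paths-br i {ζ} (P , post , pζ) = P′ , post′ , inj₂ (refl , refl)
      where
      P′ : T → S → Set
      P′ K υ = P K υ ⊎ (K ≡ G × υ ≡ cons (comm d p q (lab i)) ζ)
      post′ : PostFixed P′
      post′ K υ (inj₁ pυ)            = Unfold-map inj₁ (post K υ pυ)
      post′ K υ (inj₂ (refl , refl)) = u-br view-G i ζ (λ _ → refl) (inj₁ pζ)

    ∈Paths-br⁻ : {ξ : S} → ξ ∈Paths G →
                 Σ (Fin (suc n)) λ i → Σ S λ ζ →
                   ξ ≐ cons (comm d p q (lab i)) ζ × ζ ∈Paths cont i
    ∈Paths-br⁻ {ξ} (P , post , pξ) with post G ξ pξ
    ... | u-end e _ with trans (sym view-G) e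
    ...   | ()
    ∈Paths-br⁻ {ξ} (P , post , pξ) | u-br e i ζ s pζ with trans (sym view-G) e
    ...   | refl = i , ζ , s , (P , post , pζ)

  Insertable : Comm Part Label → T → T → Set₁
  Insertable β G G′ = ∀ (ξ : S) → ξ ∈Paths G′ →
    Σ (List (Comm Part Label)) λ ξ₁ → Σ S λ ξ₂ →
      ξ ≐ (ξ₁ · ξ₂) × (ξ₁ · cons β ξ₂) ∈Paths G

  Insertable-top : ∀ {G : T} {d p q pq n lab cont} {inj : Injective _≡_ _≡_ lab} →
                   view G ≡ br d p q pq n lab inj cont → (h : Fin (suc n)) →
                   Insertable (comm d p q (lab h)) G (cont h)
  Insertable-top view-G h ξ pξ = [] , ξ , (λ _ → refl) , ∈Paths-br view-G h pξ

  Insertable-br : ∀ {G G′ : T} {β d p q pq n lab cont cont′} {inj : Injective _≡_ _≡_ lab} →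
                  view G ≡ br d p q pq n lab inj cont →
                  view G′ ≡ br d p q pq n lab inj cont′ →
                  (∀ i → Insertable β (cont i) (cont′ i)) → Insertable β G G′
  Insertable-br {d = d} {p} {q} {lab = lab} view-G view-G′ ins ξ pξ
    with ∈Paths-br⁻ view-G′ pξ
  ... | i , ζ , ξ≐ , pζ with ins i ζ pζ
  ...   | ξ₁ , ξ₂ , ζ≐ , pins =
    comm d p q (lab i) ∷ ξ₁ , ξ₂ , ≐-cons-· ξ ζ ξ₁ ξ₂ ξ≐ ζ≐ , ∈Paths-br view-G i pins

  Insertable-resp-≈ᵀ : ∀ {β} {G G′ H H′ : T} → G ≈ᵀ H → G′ ≈ᵀ H′ →
                       Insertable β G G′ → Insertable β H H′
  Insertable-resp-≈ᵀ G≈H G′≈H′ ins ξ pξ with ins ξ (∈Paths-resp-≈ᵀ (≈ᵀ-sym G′≈H′) pξ)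
  ... | ξ₁ , ξ₂ , ξ≐ , pins = ξ₁ , ξ₂ , ξ≐ , ∈Paths-resp-≈ᵀ G≈H pins

lemma4p10 : ∀ {Part Label : Set} {G G' : GT Part Label} {M M' : Queue Part Label}
              {β : Comm Part Label} →
            Step G M β G' M' →
            ∀ (ξ : Seq (Comm Part Label)) → ξ ∈Paths G' →
            Σ (List (Comm Part Label)) λ ξ₁ → Σ (Seq (Comm Part Label)) λ ξ₂ →
              (ξ ≐ (ξ₁ · ξ₂)) × ((ξ₁ · cons β ξ₂) ∈Paths G)
lemma4p10 (top-out h view-G)                 = Insertable-top view-G h
lemma4p10 (top-in h view-G)                  = Insertable-top view-G h
lemma4p10 (inside-out view-G view-G′ _ st)   = Insertable-br view-G view-G′ (λ i → lemma4p10 (st i))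
lemma4p10 (inside-in _ view-G view-G′ _ st)  = Insertable-br view-G view-G′ (λ i → lemma4p10 (st i))
lemma4p10 (conv st G≈H G′≈H′ _ _)            = Insertable-resp-≈ᵀ G≈H G′≈H′ (lemma4p10 st)
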